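{- $6$ is the only even perfect number that is evil.
   Context: A positive integer is perfect if it equals the sum of its proper divisors (its positive divisors other than itself), e.g. $6 = 1+2+3$. A positive integer is called evil if its binary expansion contains an even number of ones. -}

module Defs where

open import Data.Nat using (ℕ; zero; suc; _+_; _*_; _<_)
open import Data.Nat.DivMod using (_%_; _/_)
open import Data.Nat.Divisibility using (_∣_; _∣?_)
open import Relation.Binary.PropositionalEquality using (_≡_)
open import Data.List using (List; filter; upTo; drop)
open import Data.Nat.ListAction using (sum)
open import Data.Product using (_×_)

properDivisors : ℕ → List ℕ
properDivisors n = filter (_∣? n) (drop 1 (upTo n))

Perfect : ℕ → Set
Perfect n = (0 < n) × (sum (properDivisors n) ≡ n)

-- Number of ones in the binary expansion of n (fuel-based; fuel n suffices
-- since each step at least halves a positive number).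
onesAux : ℕ → ℕ → ℕ
onesAux zero    m = 0
onesAux (suc f) m = m % 2 + onesAux f (m / 2)

binaryOnes : ℕ → ℕ
binaryOnes n = onesAux n n

Evil : ℕ → Set
Evil n = (0 < n) × (2 ∣ binaryOnes n)

-- The proof follows Euclid–Euler.  The divisor sum σ n is written as a sum
-- over the range d < n + 1 of the term "d if d ∣ n, else 0".  Splitting that
-- range into even and odd indices gives σ (2N) = 2 σ N + σodd N, where σodd
-- is the sum of odd divisors, and σodd (2N) = σodd N.  Iterating, for odd m,
--   σ (2^k m) + σ m = 2^(k+1) σ m.
-- If n = 2^k m (k ≥ 1, m odd) is perfect, this identity forces σ m = m + 1
-- and m + 1 = 2^(k+1); i.e. n = 2^k (2^(k+1) − 1) where m has no divisor
-- strictly between 1 and m (Euclid's form).  The binary expansion of such n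
-- is k + 1 ones followed by k zeros, so n is evil exactly when k + 1 is even.
-- Then m = 4^j − 1 is a multiple of 3, and having no nontrivial divisor
-- forces m = 3, hence n = 6.
module Submission where

open import Defs
open import Data.Nat.Divisibility using (_∣_)
open import Data.Product using (_×_)
open import Relation.Binary.PropositionalEquality using (_≡_)

open import Data.Nat
open import Data.Nat.Properties
open import Data.Nat.Divisibility
open import Data.Nat.Coprimality using (Coprime; coprime-divisor)
open import Data.Nat.DivMod
open import Data.Nat.Induction using (<-rec)
open import Data.Nat.ListAction using (sum)
open import Data.Nat.ListAction.Properties using (sum-++)
open import Data.Nat.Solver using (module +-*-Solver)
open import Data.List using ([]; _∷_; filter; applyUpTo; map; _∷ʳ_)
open import Data.List.Properties using (applyUpTo-∷ʳ; map-applyUpTo)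
open import Data.Product using (Σ; ∃₂; _,_; proj₁; proj₂)
open import Function using (_∘_)
open import Data.Sum using (_⊎_; inj₁; inj₂)
open import Data.Empty using (⊥-elim)
open import Relation.Nullary using (¬_; yes; no)
open import Relation.Binary.PropositionalEquality
  using (refl; sym; trans; cong; cong₂; subst; module ≡-Reasoning)

open +-*-Solver using (solve; _:+_; _:*_; _:=_; con)

sumBelow : (ℕ → ℕ) → ℕ → ℕ
sumBelow g zero    = 0
sumBelow g (suc N) = sumBelow g N + g N

sum-applyUpTo : ∀ g k → sum (applyUpTo g k) ≡ sumBelow g k
sum-applyUpTo g zero    = refl
sum-applyUpTo g (suc k) = begin
  sum (applyUpTo g (suc k))       ≡⟨ cong sum (sym (applyUpTo-∷ʳ g k)) ⟩
  sum (applyUpTo g k ∷ʳ g k)      ≡⟨ sum-++ (applyUpTo g k) (g k ∷ []) ⟩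
  sum (applyUpTo g k) + (g k + 0) ≡⟨ cong₂ _+_ (sum-applyUpTo g k) (+-identityʳ (g k)) ⟩
  sumBelow g k + g k              ∎
  where open ≡-Reasoning

sumBelow-cong : ∀ {f g} N → (∀ d → f d ≡ g d) → sumBelow f N ≡ sumBelow g N
sumBelow-cong zero    f≗g = refl
sumBelow-cong (suc N) f≗g = cong₂ _+_ (sumBelow-cong N f≗g) (f≗g N)

sumBelow-zero : ∀ N → sumBelow (λ _ → 0) N ≡ 0
sumBelow-zero zero    = refl
sumBelow-zero (suc N) = trans (+-identityʳ _) (sumBelow-zero N)

sumBelow-scale : ∀ c g N → sumBelow (λ e → c * g e) N ≡ c * sumBelow g N
sumBelow-scale c g zero    = sym (*-zeroʳ c)
sumBelow-scale c g (suc N) =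
  trans (cong (_+ c * g N) (sumBelow-scale c g N)) (sym (*-distribˡ-+ c (sumBelow g N) (g N)))

sumBelow-stable : ∀ {g a L} → (∀ d → a ≤ d → g d ≡ 0) → a ≤ L → sumBelow g L ≡ sumBelow g a
sumBelow-stable {g} {a} {L} vanish a≤L =
  trans (cong (sumBelow g) (sym (m∸n+n≡m a≤L))) (extend (L ∸ a))
  where
  extend : ∀ j → sumBelow g (j + a) ≡ sumBelow g a
  extend zero    = refl
  extend (suc j) = trans (cong₂ _+_ (extend j) (vanish (j + a) (m≤n+m a j))) (+-identityʳ _)

sumBelow-mono : ∀ g {a N} → a ≤ N → sumBelow g a ≤ sumBelow g N
sumBelow-mono g {a} {N} a≤N = subst (λ L → sumBelow g a ≤ sumBelow g L) (m∸n+n≡m a≤N) (grow (N ∸ a))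
  where
  grow : ∀ j → sumBelow g a ≤ sumBelow g (j + a)
  grow zero    = ≤-refl
  grow (suc j) = ≤-trans (grow j) (m≤m+n _ _)

sumBelow-three : ∀ g {a b c N} → a < b → b < c → c < N → g a + g b + g c ≤ sumBelow g N
sumBelow-three g {a} {b} {c} a<b b<c c<N =
  ≤-trans (+-monoˡ-≤ (g c) (+-monoˡ-≤ (g b) (≤-trans (m≤n+m (g a) (sumBelow g a)) (sumBelow-mono g a<b))))
    (≤-trans (+-monoˡ-≤ (g c) (sumBelow-mono g b<c)) (sumBelow-mono g c<N))

sumBelow-evenOdd : ∀ g N →
  sumBelow g (2 * N) ≡ sumBelow (λ e → g (2 * e)) N + sumBelow (λ e → g (suc (2 * e))) N
sumBelow-evenOdd g zero    = refl
sumBelow-evenOdd g (suc N) = begin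
  sumBelow g (2 * suc N)                  ≡⟨ cong (sumBelow g) (*-suc 2 N) ⟩
  sumBelow g (2 * N) + g (2 * N) + g (suc (2 * N))
    ≡⟨ cong (λ s → s + g (2 * N) + g (suc (2 * N))) (sumBelow-evenOdd g N) ⟩
  Ev + Od + g (2 * N) + g (suc (2 * N))   ≡⟨ interchange Ev Od (g (2 * N)) (g (suc (2 * N))) ⟩
  (Ev + g (2 * N)) + (Od + g (suc (2 * N))) ∎
  where
  open ≡-Reasoning
  Ev = sumBelow (λ e → g (2 * e)) N
  Od = sumBelow (λ e → g (suc (2 * e))) N
  interchange : ∀ a b c d → a + b + c + d ≡ (a + c) + (b + d)
  interchange = solve 4 (λ a b c d → a :+ b :+ c :+ d := (a :+ c) :+ (b :+ d)) refl

even⊎odd : ∀ n → (Σ ℕ λ h → n ≡ 2 * h) ⊎ (Σ ℕ λ h → n ≡ suc (2 * h))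
even⊎odd zero    = inj₁ (0 , refl)
even⊎odd (suc n) with even⊎odd n
... | inj₁ (h , n≡2h)   = inj₂ (h , cong suc n≡2h)
... | inj₂ (h , n≡2h+1) = inj₁ (suc h , trans (cong suc n≡2h+1) (sym (*-suc 2 h)))

odd-∤2 : ∀ e → ¬ 2 ∣ suc (2 * e)
odd-∤2 e 2∣odd with ∣1⇒≡1 (∣m+n∣m⇒∣n (subst (2 ∣_) (+-comm 1 (2 * e)) 2∣odd) (m∣m*n e))
... | ()

odd-coprime-2 : ∀ e → Coprime (suc (2 * e)) 2
odd-coprime-2 e {zero}                (_ , 0∣2)   with 0∣⇒≡0 0∣2
... | ()
odd-coprime-2 e {suc zero}            _           = refl
odd-coprime-2 e {suc (suc zero)}      (2∣odd , _) = ⊥-elim (odd-∤2 e 2∣odd)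
odd-coprime-2 e {suc (suc (suc d))}   (_ , d∣2)   with ∣⇒≤ d∣2
... | s≤s (s≤s ())

odd∣double⇒∣ : ∀ e N → suc (2 * e) ∣ 2 * N → suc (2 * e) ∣ N
odd∣double⇒∣ e N = coprime-divisor (odd-coprime-2 e)

twoPower×odd : ∀ n → 0 < n → ∃₂ λ k t → n ≡ 2 ^ k * suc (2 * t)
twoPower×odd = <-rec _ split
  where
  split : ∀ n → (∀ {h} → h < n → 0 < h → ∃₂ λ k t → h ≡ 2 ^ k * suc (2 * t)) →
          0 < n → ∃₂ λ k t → n ≡ 2 ^ k * suc (2 * t)
  split n rec 0<n with even⊎odd n
  ... | inj₂ (t , n≡odd)     = 0 , t , trans n≡odd (sym (*-identityˡ _))
  ... | inj₁ (zero , refl)   = ⊥-elim (<-irrefl refl 0<n)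
  ... | inj₁ (suc h , refl) with rec (m<m+n (suc h) (s≤s z≤n)) (s≤s z≤n)
  ...   | k , t , h≡ = suc k , t , trans (cong (2 *_) h≡) (sym (*-assoc 2 (2 ^ k) _))

divisorTerm : ℕ → ℕ → ℕ
divisorTerm n d with d ∣? n
... | yes _ = d
... | no  _ = 0

divisorTerm-∣ : ∀ {n d} → d ∣ n → divisorTerm n d ≡ d
divisorTerm-∣ {n} {d} d∣n with d ∣? n
... | yes _  = refl
... | no d∤n = ⊥-elim (d∤n d∣n)

divisorTerm-∤ : ∀ {n d} → ¬ d ∣ n → divisorTerm n d ≡ 0
divisorTerm-∤ {n} {d} d∤n with d ∣? n
... | yes d∣n = ⊥-elim (d∤n d∣n)
... | no _    = refl

divisorTerm-0 : ∀ n → divisorTerm n 0 ≡ 0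
divisorTerm-0 n with 0 ∣? n
... | yes _ = refl
... | no  _ = refl

divisorTerm-large : ∀ {n d} → 0 < n → n < d → divisorTerm n d ≡ 0
divisorTerm-large 0<n n<d = divisorTerm-∤ (λ d∣n → <⇒≱ n<d (∣⇒≤ {{>-nonZero 0<n}} d∣n))

divisorTerm-double-even : ∀ N e → divisorTerm (2 * N) (2 * e) ≡ 2 * divisorTerm N e
divisorTerm-double-even N e with e ∣? N
... | yes e∣N = divisorTerm-∣ (*-monoʳ-∣ 2 e∣N)
... | no  e∤N = divisorTerm-∤ (λ 2e∣2N → e∤N (*-cancelˡ-∣ 2 2e∣2N))

divisorTerm-double-odd : ∀ N e → divisorTerm (2 * N) (suc (2 * e)) ≡ divisorTerm N (suc (2 * e))
divisorTerm-double-odd N e with suc (2 * e) ∣? N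
... | yes d∣N = divisorTerm-∣ (∣-trans d∣N (n∣m*n 2))
... | no  d∤N = divisorTerm-∤ (λ d∣2N → d∤N (odd∣double⇒∣ e N d∣2N))

divisorTerm-odd-even : ∀ t e → divisorTerm (suc (2 * t)) (2 * e) ≡ 0
divisorTerm-odd-even t e = divisorTerm-∤ (λ 2e∣odd → odd-∤2 t (∣-trans (m∣m*n e) 2e∣odd))

σ : ℕ → ℕ
σ n = sumBelow (divisorTerm n) (suc n)

σodd : ℕ → ℕ
σodd n = sumBelow (λ e → divisorTerm n (suc (2 * e))) n

σ-range : ∀ {n L} → 0 < n → n < L → sumBelow (divisorTerm n) L ≡ σ n
σ-range 0<n n<L = sumBelow-stable (λ d n<d → divisorTerm-large 0<n n<d) n<L

σodd-range : ∀ {n L} → 0 < n → n ≤ L → sumBelow (λ e → divisorTerm n (suc (2 * e))) L ≡ σodd n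
σodd-range {n} 0<n n≤L = sumBelow-stable vanish n≤L
  where
  vanish : ∀ e → n ≤ e → divisorTerm n (suc (2 * e)) ≡ 0
  vanish e n≤e = divisorTerm-large 0<n (s≤s (≤-trans n≤e (m≤m+n e (e + 0))))

-- A perfect number is half its divisor sum: its proper divisors add up to
-- n, and n itself contributes another n.
perfect⇒σ : ∀ n → Perfect n → σ n ≡ n + n
perfect⇒σ (suc n) (_ , proper≡n) = cong₂ _+_ (trans (sym proper≡σ-self) proper≡n) (divisorTerm-∣ ∣-refl)
  where
  proper≡σ-self : sum (properDivisors (suc n)) ≡ sumBelow (divisorTerm (suc n)) (suc n)
  proper≡σ-self = begin
    sum (filter (_∣? suc n) (applyUpTo suc n))      ≡⟨ sumFilter (applyUpTo suc n) ⟩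
    sum (map (divisorTerm (suc n)) (applyUpTo suc n)) ≡⟨ cong sum (map-applyUpTo suc (divisorTerm (suc n)) n) ⟩
    sum (applyUpTo (divisorTerm (suc n) ∘ suc) n)
      ≡⟨ cong (_+ sum (applyUpTo (divisorTerm (suc n) ∘ suc) n)) (sym (divisorTerm-0 (suc n))) ⟩
    sum (applyUpTo (divisorTerm (suc n)) (suc n))    ≡⟨ sum-applyUpTo (divisorTerm (suc n)) (suc n) ⟩
    sumBelow (divisorTerm (suc n)) (suc n)           ∎
    where
    open ≡-Reasoning
    sumFilter : ∀ xs → sum (filter (_∣? suc n) xs) ≡ sum (map (divisorTerm (suc n)) xs)
    sumFilter []       = refl
    sumFilter (x ∷ xs) with x ∣? suc n
    ... | yes _ = cong (x +_) (sumFilter xs)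
    ... | no  _ = sumFilter xs

-- Doubling: the divisors of 2N are twice the divisors of N, plus the odd
-- divisors of N.
σ-double : ∀ N → 0 < N → σ (2 * N) ≡ 2 * σ N + σodd N
σ-double N 0<N = begin
  σ (2 * N)                                ≡⟨ sym (σ-range 0<2N 2N<2[N+1]) ⟩
  sumBelow (divisorTerm (2 * N)) (2 * suc N) ≡⟨ sumBelow-evenOdd (divisorTerm (2 * N)) (suc N) ⟩
  sumBelow (λ e → divisorTerm (2 * N) (2 * e)) (suc N)
    + sumBelow (λ e → divisorTerm (2 * N) (suc (2 * e))) (suc N)
    ≡⟨ cong₂ _+_ (trans (sumBelow-cong (suc N) (divisorTerm-double-even N))
                        (sumBelow-scale 2 (divisorTerm N) (suc N)))
                 (trans (sumBelow-cong (suc N) (divisorTerm-double-odd N))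
                        (σodd-range 0<N (n≤1+n N))) ⟩
  2 * σ N + σodd N                         ∎
  where
  open ≡-Reasoning
  0<2N : 0 < 2 * N
  0<2N = *-monoʳ-< 2 0<N
  2N<2[N+1] : 2 * N < 2 * suc N
  2N<2[N+1] = *-monoʳ-< 2 (n<1+n N)

σodd-double : ∀ N → 0 < N → σodd (2 * N) ≡ σodd N
σodd-double N 0<N =
  trans (sumBelow-cong (2 * N) (divisorTerm-double-odd N)) (σodd-range 0<N (m≤m+n N (N + 0)))

-- An odd number has only odd divisors.
σ-odd : ∀ t → σ (suc (2 * t)) ≡ σodd (suc (2 * t))
σ-odd t = begin
  σ m                                                ≡⟨ sym (σ-range (s≤s z≤n) m<2[t+1]) ⟩
  sumBelow (divisorTerm m) (2 * suc t)               ≡⟨ sumBelow-evenOdd (divisorTerm m) (suc t) ⟩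
  sumBelow (λ e → divisorTerm m (2 * e)) (suc t) + sumBelow oddTerm (suc t)
    ≡⟨ cong (_+ sumBelow oddTerm (suc t))
            (trans (sumBelow-cong (suc t) (divisorTerm-odd-even t)) (sumBelow-zero (suc t))) ⟩
  sumBelow oddTerm (suc t)                           ≡⟨ sym (sumBelow-stable vanish t<m) ⟩
  σodd m                                             ∎
  where
  open ≡-Reasoning
  m = suc (2 * t)
  oddTerm = λ e → divisorTerm m (suc (2 * e))
  m<2[t+1] : m < 2 * suc t
  m<2[t+1] = ≤-reflexive (sym (*-suc 2 t))
  t<m : suc t ≤ m
  t<m = s≤s (m≤m+n t (t + 0))
  vanish : ∀ e → suc t ≤ e → oddTerm e ≡ 0
  vanish e t<e = divisorTerm-large (s≤s z≤n) 
    (s≤s (≤-trans (n≤1+n m) (≤-trans (≤-reflexive (sym (*-suc 2 t))) (*-monoʳ-≤ 2 t<e))))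

2^k*N>0 : ∀ k N → 0 < N → 0 < 2 ^ k * N
2^k*N>0 k N 0<N = *-mono-≤ (m^n>0 2 k) 0<N

σodd-twoPower : ∀ k N → 0 < N → σodd (2 ^ k * N) ≡ σodd N
σodd-twoPower zero    N 0<N = cong σodd (*-identityˡ N)
σodd-twoPower (suc k) N 0<N = begin
  σodd (2 ^ suc k * N)     ≡⟨ cong σodd (*-assoc 2 (2 ^ k) N) ⟩
  σodd (2 * (2 ^ k * N))   ≡⟨ σodd-double (2 ^ k * N) (2^k*N>0 k N 0<N) ⟩
  σodd (2 ^ k * N)         ≡⟨ σodd-twoPower k N 0<N ⟩
  σodd N                   ∎
  where open ≡-Reasoning

σ-twoPower : ∀ k N → 0 < N → σ (2 ^ k * N) + σodd N ≡ 2 ^ k * (σ N + σodd N)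
σ-twoPower zero    N 0<N = trans (cong (λ x → σ x + σodd N) (*-identityˡ N)) (sym (*-identityˡ _))
σ-twoPower (suc k) N 0<N = begin
  σ (2 ^ suc k * N) + O        ≡⟨ cong (λ x → σ x + O) (*-assoc 2 (2 ^ k) N) ⟩
  σ (2 * X) + O                ≡⟨ cong (_+ O) (σ-double X (2^k*N>0 k N 0<N)) ⟩
  2 * σ X + σodd X + O         ≡⟨ cong (λ o → 2 * σ X + o + O) (σodd-twoPower k N 0<N) ⟩
  2 * σ X + O + O              ≡⟨ twice (σ X) O ⟩
  2 * (σ X + O)                ≡⟨ cong (2 *_) (σ-twoPower k N 0<N) ⟩
  2 * (2 ^ k * (σ N + O))      ≡⟨ sym (*-assoc 2 (2 ^ k) (σ N + O)) ⟩
  2 ^ suc k * (σ N + O)        ∎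
  where
  open ≡-Reasoning
  X = 2 ^ k * N
  O = σodd N
  twice : ∀ a b → 2 * a + b + b ≡ 2 * (a + b)
  twice = solve 2 (λ a b → con 2 :* a :+ b :+ b := con 2 :* (a :+ b)) refl

σ-nontrivialDivisor : ∀ {m b} → 1 < b → b < m → b ∣ m → 1 + b + m ≤ σ m
σ-nontrivialDivisor {m} {b} 1<b b<m b∣m =
  subst (_≤ σ m) (cong₂ _+_ (cong₂ _+_ (divisorTerm-∣ (1∣ m)) (divisorTerm-∣ b∣m)) (divisorTerm-∣ ∣-refl))
    (sumBelow-three (divisorTerm m) 1<b b<m (n<1+n m))

-- 1 + b + a ≰ a + b: the contradiction reached whenever σ m is pushed
-- above its known value.
no-room : ∀ a b → ¬ (1 + b + a ≤ a + b)
no-room a b le = <-irrefl refl (subst (λ s → suc s ≤ a + b) (+-comm b a) le)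

-- If σ m = m + d and m + d = (3 + r) d, then d is a divisor of m strictly
-- between 1 and m unless d = 1; so d = 1.
excess≡1 : ∀ {m} r d → 0 < m → m + d ≡ (3 + r) * d → σ m ≡ m + d → d ≡ 1
excess≡1 {suc m} r zero _ m+0≡0 _ with trans m+0≡0 (*-zeroʳ (3 + r))
... | ()
excess≡1 r (suc zero) _ _ _ = refl
excess≡1 {m} r (suc (suc d)) _ m+D≡ σ≡ =
  ⊥-elim (no-room m D (≤-trans (σ-nontrivialDivisor (s≤s (s≤s z≤n)) D<m (divides (2 + r) m≡)) (≤-reflexive σ≡)))
  where
  D = suc (suc d)
  m≡ : m ≡ (2 + r) * D
  m≡ = +-cancelʳ-≡ D m ((2 + r) * D) (trans m+D≡ (+-comm D _))
  D<m : D < m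
  D<m = subst (D <_) (sym m≡) (m<m+n D {D + r * D} (s≤s z≤n))

σ-fromEquation : ∀ P m → 3 ≤ P → 0 < m → P * m + σ m ≡ P * σ m → σ m ≡ m + 1 × suc m ≡ P
σ-fromEquation P m 3≤P 0<m equation = σ≡m+1 , trans (+-comm 1 m) m+1≡P
  where
  m≤σ : m ≤ σ m
  m≤σ = ≤-trans (≤-reflexive (sym (divisorTerm-∣ {m} ∣-refl))) (m≤n+m _ _)
  d = σ m ∸ m
  σ≡m+d : σ m ≡ m + d
  σ≡m+d = sym (m+[n∸m]≡n m≤σ)
  m+d≡Pd : m + d ≡ P * d
  m+d≡Pd = +-cancelˡ-≡ (P * m) (m + d) (P * d) (begin
    P * m + (m + d)   ≡⟨ cong (P * m +_) (sym σ≡m+d) ⟩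
    P * m + σ m       ≡⟨ equation ⟩
    P * σ m           ≡⟨ cong (P *_) σ≡m+d ⟩
    P * (m + d)       ≡⟨ *-distribˡ-+ P m d ⟩
    P * m + P * d     ∎)
    where open ≡-Reasoning
  d≡1 : d ≡ 1
  d≡1 = excess≡1 (P ∸ 3) d 0<m (trans m+d≡Pd (cong (_* d) (sym (m+[n∸m]≡n 3≤P)))) σ≡m+d
  σ≡m+1 : σ m ≡ m + 1
  σ≡m+1 = trans σ≡m+d (cong (m +_) d≡1)
  m+1≡P : m + 1 ≡ P
  m+1≡P = trans (subst (λ e → m + e ≡ P * e) d≡1 m+d≡Pd) (*-identityʳ P)

record EuclidForm (n : ℕ) : Set where
  field
    k m          : ℕ
    n≡2^k*m      : n ≡ 2 ^ k * m
    m+1≡2^[k+1]  : suc m ≡ 2 ^ suc k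
    σm≡m+1       : σ m ≡ m + 1

evenPerfect⇒EuclidForm : ∀ n → Perfect n → 2 ∣ n → EuclidForm n
evenPerfect⇒EuclidForm n perfect 2∣n with twoPower×odd n (proj₁ perfect)
... | zero , t , n≡odd = ⊥-elim (odd-∤2 t (subst (2 ∣_) (trans n≡odd (*-identityˡ _)) 2∣n))
... | suc k , t , n≡ = record
  { k = suc k ; m = m ; n≡2^k*m = n≡ ; m+1≡2^[k+1] = proj₂ euclid ; σm≡m+1 = proj₁ euclid }
  where
  open ≡-Reasoning
  m = suc (2 * t)
  P = 2 ^ suc (suc k)
  σn≡Pm : σ (2 ^ suc k * m) ≡ P * m
  σn≡Pm = begin
    σ (2 ^ suc k * m)    ≡⟨ cong σ (sym n≡) ⟩
    σ n                  ≡⟨ perfect⇒σ n perfect ⟩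
    n + n                ≡⟨ cong (n +_) (sym (+-identityʳ n)) ⟩
    2 * n                ≡⟨ cong (2 *_) n≡ ⟩
    2 * (2 ^ suc k * m)  ≡⟨ sym (*-assoc 2 (2 ^ suc k) m) ⟩
    P * m                ∎
  equation : P * m + σ m ≡ P * σ m
  equation = begin
    P * m + σ m                      ≡⟨ cong₂ _+_ (sym σn≡Pm) (σ-odd t) ⟩
    σ (2 ^ suc k * m) + σodd m       ≡⟨ σ-twoPower (suc k) m (s≤s z≤n) ⟩
    2 ^ suc k * (σ m + σodd m)       ≡⟨ cong (λ o → 2 ^ suc k * (σ m + o)) (sym (σ-odd t)) ⟩
    2 ^ suc k * (σ m + σ m)          ≡⟨ double (2 ^ suc k) (σ m) ⟩
    P * σ m                          ∎
    where
    double : ∀ a b → a * (b + b) ≡ 2 * a * b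
    double = solve 2 (λ a b → a :* (b :+ b) := con 2 :* a :* b) refl
  3≤P : 3 ≤ P
  3≤P = ≤-trans (n≤1+n 3) (^-monoʳ-≤ 2 {2} {suc (suc k)} (s≤s (s≤s z≤n)))
  euclid : σ m ≡ m + 1 × suc m ≡ P
  euclid = σ-fromEquation P m 3≤P (s≤s z≤n) equation

onesAux-double : ∀ f x → onesAux (suc f) (2 * x) ≡ onesAux f x
onesAux-double f x = subst (λ y → onesAux (suc f) y ≡ onesAux f x) (*-comm x 2)
  (cong₂ (λ b q → b + onesAux f q) (m*n%n≡0 x 2) (m*n/n≡m x 2))

onesAux-odd : ∀ f x → onesAux (suc f) (suc (2 * x)) ≡ suc (onesAux f x)
onesAux-odd f x = subst (λ y → onesAux (suc f) (suc y) ≡ suc (onesAux f x)) (*-comm x 2)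
  (cong₂ (λ b q → b + onesAux f q) ([m+kn]%n≡m%n 1 x 2)
         (trans (+-distrib-/-∣ʳ 1 {x * 2} {2} (divides x refl)) (m*n/n≡m x 2)))

onesAux-shift : ∀ k f y → onesAux (k + f) (2 ^ k * y) ≡ onesAux f y
onesAux-shift zero    f y = cong (onesAux f) (*-identityˡ y)
onesAux-shift (suc k) f y = begin
  onesAux (suc k + f) (2 ^ suc k * y)   ≡⟨ cong (onesAux (suc k + f)) (*-assoc 2 (2 ^ k) y) ⟩
  onesAux (suc k + f) (2 * (2 ^ k * y)) ≡⟨ onesAux-double (k + f) (2 ^ k * y) ⟩
  onesAux (k + f) (2 ^ k * y)           ≡⟨ onesAux-shift k f y ⟩
  onesAux f y                           ∎
  where open ≡-Reasoning

onesAux-zero : ∀ f → onesAux f 0 ≡ 0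
onesAux-zero zero    = refl
onesAux-zero (suc f) = onesAux-zero f

onesAux-allOnes : ∀ j f x → suc x ≡ 2 ^ j → onesAux (j + f) x ≡ j
onesAux-allOnes zero    f zero    _ = onesAux-zero f
onesAux-allOnes zero    f (suc x) ()
onesAux-allOnes (suc j) f x x+1≡2^[j+1] with even⊎odd x
... | inj₁ (h , refl) = ⊥-elim (odd-∤2 h (subst (2 ∣_) (sym x+1≡2^[j+1]) (m∣m*n (2 ^ j))))
... | inj₂ (h , refl) = trans (onesAux-odd (j + f) h) (cong suc (onesAux-allOnes j f h h+1≡2^j))
  where
  h+1≡2^j : suc h ≡ 2 ^ j
  h+1≡2^j = *-cancelˡ-≡ (suc h) (2 ^ j) 2 (trans (*-suc 2 h) x+1≡2^[j+1])

-- Bounds the length k + (k + 1) of the binary expansion below.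
n<2^n : ∀ n → n < 2 ^ n
n<2^n zero    = s≤s z≤n
n<2^n (suc n) = ≤-trans (s≤s (m≤n+m (suc n) n))
  (+-mono-≤ (n<2^n n) (subst (suc n ≤_) (sym (+-identityʳ _)) (n<2^n n)))

-- The number 2^k (2^(k+1) − 1) has k + 1 ones (followed by k zeros); the
-- fuel n of binaryOnes exceeds the 2k + 1 digits needed.
binaryOnes-euclid : ∀ k m → suc m ≡ 2 ^ suc k → binaryOnes (2 ^ k * m) ≡ suc k
binaryOnes-euclid k m m+1≡2^[k+1] = begin
  onesAux n n                        ≡⟨ cong (λ f → onesAux f n) fuel ⟩
  onesAux (k + (suc k + spare)) n    ≡⟨ onesAux-shift k (suc k + spare) m ⟩
  onesAux (suc k + spare) m          ≡⟨ onesAux-allOnes (suc k) spare m m+1≡2^[k+1] ⟩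
  suc k                              ∎
  where
  open ≡-Reasoning
  n = 2 ^ k * m
  2k+1≤m : k + suc k ≤ m
  2k+1≤m = subst (λ s → k + suc s ≤ m) (+-identityʳ k)
    (≤-pred (subst (2 * suc k ≤_) (sym m+1≡2^[k+1]) (*-monoʳ-≤ 2 (n<2^n k))))
  m≤n : m ≤ n
  m≤n = m≤n*m m (2 ^ k) {{m^n≢0 2 k}}
  spare = n ∸ (k + suc k)
  fuel : n ≡ k + (suc k + spare)
  fuel = trans (sym (m∸n+n≡m (≤-trans 2k+1≤m m≤n)))
    (trans (+-comm spare (k + suc k)) (+-assoc k (suc k) spare))

-- 4^j ≡ 1 (mod 3): a number one below an even power of 2 is a multiple of 3.
3∣evenMersenne : ∀ j m → suc m ≡ 2 ^ (j * 2) → 3 ∣ m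
3∣evenMersenne j m m+1≡4^j = divides (proj₁ (4^j≡1+3r j)) (suc-injective (trans m+1≡4^j (proj₂ (4^j≡1+3r j))))
  where
  4^j≡1+3r : ∀ j → Σ ℕ λ r → 2 ^ (j * 2) ≡ suc (r * 3)
  4^j≡1+3r zero    = 0 , refl
  4^j≡1+3r (suc j) with 4^j≡1+3r j
  ... | r , 4^j≡ = suc (4 * r) , trans (cong (λ x → 2 * (2 * x)) 4^j≡) (times4 r)
    where
    times4 : ∀ r → 2 * (2 * suc (r * 3)) ≡ suc (suc (4 * r) * 3)
    times4 = solve 1 (λ r → con 2 :* (con 2 :* (con 1 :+ r :* con 3)) := con 1 :+ (con 1 :+ con 4 :* r) :* con 3) refl

-- If σ m = m + 1 (no divisor strictly between 1 and m) and 3 ∣ m, then m = 3;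
-- the case m = 0 is excluded since σ 0 = 0.
σ≡m+1∧3∣m⇒m≡3 : ∀ {m} → σ m ≡ m + 1 → 3 ∣ m → m ≡ 3
σ≡m+1∧3∣m⇒m≡3 () (divides zero refl)
σ≡m+1∧3∣m⇒m≡3 _ (divides (suc zero) m≡3) = m≡3
σ≡m+1∧3∣m⇒m≡3 {m} σ≡m+1 3∣m@(divides (suc (suc q)) m≡) =
  ⊥-elim (no-room m 3 (≤-trans (σ-nontrivialDivisor (s≤s (s≤s z≤n)) 3<m 3∣m)
                               (≤-trans (≤-reflexive σ≡m+1) (+-monoʳ-≤ m (s≤s z≤n)))))
  where
  3<m : 3 < m
  3<m = subst (3 <_) (sym m≡) (m<m+n 3 {3 + q * 3} (s≤s z≤n))

evenPerfectEvil⇒6 : (n : ℕ) → Perfect n → 2 ∣ n → Evil n → n ≡ 6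
evenPerfectEvil⇒6 n perfect 2∣n (_ , 2∣ones) = *-cancelˡ-≡ n 6 2 (begin
  2 * n              ≡⟨ cong (2 *_) n≡2^k*m ⟩
  2 * (2 ^ k * m)    ≡⟨ sym (*-assoc 2 (2 ^ k) m) ⟩
  2 ^ suc k * m      ≡⟨ cong (_* m) (sym m+1≡2^[k+1]) ⟩
  suc m * m          ≡⟨ cong (λ x → suc x * x) m≡3 ⟩
  12                 ∎)
  where
  open ≡-Reasoning
  open EuclidForm (evenPerfect⇒EuclidForm n perfect 2∣n)
  ones≡k+1 : binaryOnes n ≡ suc k
  ones≡k+1 = trans (cong binaryOnes n≡2^k*m) (binaryOnes-euclid k m m+1≡2^[k+1])
  2∣k+1 : 2 ∣ suc k
  2∣k+1 = subst (2 ∣_) ones≡k+1 2∣ones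
  3∣m : 3 ∣ m
  3∣m = 3∣evenMersenne (quotient 2∣k+1) m (trans m+1≡2^[k+1] (cong (2 ^_) (_∣_.equality 2∣k+1)))
  m≡3 : m ≡ 3
  m≡3 = σ≡m+1∧3∣m⇒m≡3 σm≡m+1 3∣m

mainTheorem3 : (Perfect 6 × 2 ∣ 6 × Evil 6)
    × ((n : ℕ) → Perfect n → 2 ∣ n → Evil n → n ≡ 6)
mainTheorem3 = (six-perfect , divides 3 refl , six-evil) , evenPerfectEvil⇒6
  where
  -- 6 = 1 + 2 + 3, and 6 = 110 in binary
  six-perfect : Perfect 6
  six-perfect = s≤s z≤n , refl
  six-evil : Evil 6
  six-evil = s≤s z≤n , divides 1 refl
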